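{- Let $a,b$ be coprime positive integers with $a>b\geqslant 1$ and let $\beta=-a/b$. For every integer $d\in\{0,1,\ldots,a+b-1\}$, parallel addition in base $\beta$ is possible on the alphabet $\mathcal{A}_{ -d}=\{ -d,\ldots,0,\ldots,a+b-1-d\}$ (of cardinality $a+b$).
   Context: For a complex number $\beta$ with $|\beta|>1$ and a finite set $\mathcal{A}\subset\mathbb{C}$ containing $0$, let $\mathrm{Fin}_{\mathcal{A}}(\beta)=\{\sum_{j\in I}x_j\beta^j : I\subset\mathbb{Z}\text{ finite},\ x_j\in\mathcal{A}\}$. For finite alphabets $\mathcal{A},\mathcal{B}$, a map $\varphi:\mathcal{A}^{\mathbb{Z}}\to\mathcal{B}^{\mathbb{Z}}$ is $p$-local if there are integers $r,t\geqslant 0$ with $p=r+t+1$ and a map $\Phi:\mathcal{A}^p\to\mathcal{B}$ such that for every $u=(u_j)$ and $v=\varphi(u)$ one has $v_j=\Phi(u_{j+t}\cdots u_j\cdots u_{j-r})$ for all $j\in\mathbb{Z}$. A digit set conversion in base $\beta$ from $\mathcal{A}$ to $\mathcal{B}$ (both containing $0$) is a map $\varphi:\mathcal{A}^{\mathbb{Z}}\to\mathcal{B}^{\mathbb{Z}}$ such that whenever $u$ has finitely many nonzero entries, $v=\varphi(u)$ has finitely many nonzero entries and $\sum_j v_j\beta^j=\sum_j u_j\beta^j$. Parallel addition in base $\beta$ is possible on $\mathcal{A}$ if there is a digit set conversion in base $\beta$ from $\mathcal{A}+\mathcal{A}=\{x+y:x,y\in\mathcal{A}\}$ to $\mathcal{A}$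 that is $p$-local for some $p$. -}

module Defs where

open import Data.Nat as ℕ using (ℕ; zero; suc; NonZero)
open import Data.Nat.Properties using (m^n≢0)
open import Data.Integer as ℤ using (ℤ; +_; -[1+_]; ∣_∣)
open import Data.Rational as ℚ using (ℚ; 0ℚ)
open import Data.Fin using (Fin; toℕ)
open import Data.Product using (Σ; ∃; ∃-syntax; _×_; _,_)
open import Relation.Binary.PropositionalEquality using (_≡_)

Alphabet : Set₁
Alphabet = ℤ → Set

Seq : Set
Seq = ℤ → ℤ

_∈ˢ_ : Seq → Alphabet → Set
u ∈ˢ 𝒜 = ∀ j → 𝒜 (u j)

_⊕_ : Alphabet → Alphabet → Alphabet
(𝒜 ⊕ ℬ) z = ∃[ x ] ∃[ y ] (𝒜 x × ℬ y × z ≡ x ℤ.+ y)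

SupportedIn : ℕ → Seq → Set
SupportedIn N u = ∀ j → N ℕ.< ∣ j ∣ → u j ≡ + 0

sumFrom : ℤ → ℕ → (ℤ → ℚ) → ℚ
sumFrom lo zero    f = 0ℚ
sumFrom lo (suc n) f = f lo ℚ.+ sumFrom (lo ℤ.+ + 1) n f

sumSym : ℕ → (ℤ → ℚ) → ℚ
sumSym N f = sumFrom (ℤ.- (+ N)) (suc (2 ℕ.* N)) f

-- Value Σ_j u_j β^j of a sequence supported in [-N, N], where `pow j = β^j`.
value : (ℤ → ℚ) → ℕ → Seq → ℚ
value pow N u = sumSym N (λ j → (u j ℚ./ 1) ℚ.* pow j)

DigitSetConversion : (ℤ → ℚ) → Alphabet → Alphabet → (Seq → Seq) → Set
DigitSetConversion pow 𝒜 ℬ φ =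
  (∀ u → u ∈ˢ 𝒜 → φ u ∈ˢ ℬ) ×
  (∀ u → u ∈ˢ 𝒜 → ∀ N → SupportedIn N u →
     ∃[ M ] (SupportedIn M (φ u) × value pow M (φ u) ≡ value pow N u))

-- φ : 𝒜^ℤ → ℬ^ℤ is p-local: p = r + t + 1 and v_j = Φ(u_{j+t} ⋯ u_j ⋯ u_{j-r}),
-- the window being indexed by i ∈ Fin p as u_{j+t-i}.
Local : ℕ → Alphabet → (Seq → Seq) → Set
Local p 𝒜 φ =
  ∃[ r ] ∃[ t ] (p ≡ r ℕ.+ t ℕ.+ 1 ×
    Σ ((Fin p → ℤ) → ℤ) λ Φ → (∀ u → u ∈ˢ 𝒜 → ∀ j →
      φ u j ≡ Φ (λ (i : Fin p) → u (j ℤ.+ + t ℤ.- + toℕ i))))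

ParallelAddition : (ℤ → ℚ) → Alphabet → Set
ParallelAddition pow 𝒜 =
  ∃[ φ ] (DigitSetConversion pow (𝒜 ⊕ 𝒜) 𝒜 φ × ∃[ p ] Local p (𝒜 ⊕ 𝒜) φ)

βpow : (a b : ℕ) → .{{NonZero a}} → .{{NonZero b}} → ℤ → ℚ
βpow a b (+ n)     = ((ℤ.- (+ a)) ℤ.^ n) ℚ./ (b ℕ.^ n)
  where instance _ = m^n≢0 b n
βpow a b -[1+ n ]  = ((ℤ.- (+ b)) ℤ.^ suc n) ℚ./ (a ℕ.^ suc n)
  where instance _ = m^n≢0 a (suc n)

𝒜[_,_,_] : ℕ → ℕ → ℕ → Alphabet
𝒜[ a , b , d ] x = (ℤ.- (+ d)) ℤ.≤ x × x ℤ.≤ (+ (a ℕ.+ b ℕ.∸ 1)) ℤ.- (+ d)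

module Submission where

-- The converter is a carry rule.  Shift the digits of 𝒜 + 𝒜 by 2d so they
-- lie in [0, W], W = 2(a+b−1), and pick an odd window length n with
-- W·bⁿ < aⁿ (a Bernoulli-type inequality, since b < a).  The carry q_j is
-- ⌊S/N⌋, where S is the window polynomial Σ_{i<n} a^{n−1−i}(−b)^i u_{j−i}
-- (shifted and scaled) and N = (a+b)·aⁿ, and the output digit is
-- v_j = u_j − a·q_j − b·q_{j−1}.
--   * Digits: the shift identity a·P(u_j…) + b·P(u_{j−1}…) = aⁿu_j + bⁿu_{j−n}
--     turns N·(v_j + d) into a·r + b·r′ − (a+b)bⁿ(u_{j−n}+2d) with remainders
--     r, r′ < N, which forces 0 ≤ v_j + d < a + b.
--   * Value: b·β^j = −a·β^{j−1}, so v_jβ^j = u_jβ^j − (a q_jβ^j − a q_{j−1}β^{j−1})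
--     and the carries telescope away; the zero window has carry 0, so outputs
--     of finitely supported inputs are finitely supported.

module CarryRule where

  open import Data.Nat as ℕ using (ℕ; zero; suc; NonZero)
  import Data.Nat.Properties as ℕP
  open import Data.Integer as ℤ using (ℤ; +_; _+_; _*_; -_; _-_; _^_; 0ℤ; 1ℤ; _≤_; _<_)
  import Data.Integer.Properties as ℤP
  open import Data.Integer.DivMod using (_/ℕ_; _%ℕ_; a≡a%ℕn+[a/ℕn]*n; n%ℕd<d)
  open import Data.Integer.Tactic.RingSolver using (solve-∀)
  open import Data.Nat.DivMod using (m<n⇒m/n≡0)
  open import Data.Fin using (Fin; zero; suc; inject₁; fromℕ)
  open import Data.Product using (_×_; _,_; uncurry)
  open import Function using (_∘_)
  open import Relation.Binary.PropositionalEquality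
  open import Defs using (𝒜[_,_,_])

  pos-^ : ∀ x k → + (x ℕ.^ k) ≡ (+ x) ^ k
  pos-^ x zero    = refl
  pos-^ x (suc k) = trans (ℤP.pos-* x (x ℕ.^ k)) (cong (+ x *_) (pos-^ x k))

  neg-^-odd : ∀ x m → (- x) ^ suc (m ℕ.+ m) ≡ - (x ^ suc (m ℕ.+ m))
  neg-^-odd x zero    = sym (ℤP.neg-distribˡ-* x 1ℤ)
  neg-^-odd x (suc m) rewrite ℕP.+-suc m m | neg-^-odd x m =
    sq x (x ^ suc (m ℕ.+ m))
    where
    sq : ∀ x y → (- x) * ((- x) * (- y)) ≡ - (x * (x * y))
    sq = solve-∀

  -- The window polynomial P_k(y) = Σ_{i<k} A^{k-1-i} (-B)^i y_i of a window
  -- y_0 … y_{k-1}, computed Horner-style in -B.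
  module WindowPolynomial (A B : ℤ) where

    P : (k : ℕ) → (Fin k → ℤ) → ℤ
    P zero    y = 0ℤ
    P (suc k) y = A ^ k * y zero + (- B) * P k (y ∘ suc)

    P-cong : ∀ k {y y′ : Fin k → ℤ} → (∀ i → y i ≡ y′ i) → P k y ≡ P k y′
    P-cong zero    eq = refl
    P-cong (suc k) eq =
      cong₂ (λ s t → A ^ k * s + (- B) * t) (eq zero) (P-cong k (eq ∘ suc))

    -- Since B·β = -A, this is
    -- what makes the carries of neighbouring windows cancel in the output digit.
    P-shift : ∀ k (y : Fin (suc k) → ℤ) →
      A * P k (y ∘ inject₁) + B * P k (y ∘ suc) ≡ A ^ k * y zero - (- B) ^ k * y (fromℕ k)
    P-shift zero    y = base A B (y zero)
      where
      base : ∀ A B y → A * 0ℤ + B * 0ℤ ≡ 1ℤ * y - 1ℤ * y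
      base = solve-∀
    P-shift (suc k) y = begin
        A * (A ^ k * y zero + (- B) * X) + B * (A ^ k * y (suc zero) + (- B) * Y)
      ≡⟨ regroup A B (A ^ k) (y zero) (y (suc zero)) X Y ⟩
        A * A ^ k * y zero + (- B) * (A * X + B * Y) + B * A ^ k * y (suc zero)
      ≡⟨ cong (λ e → A * A ^ k * y zero + (- B) * e + B * A ^ k * y (suc zero)) (P-shift k (y ∘ suc)) ⟩
        A * A ^ k * y zero + (- B) * (A ^ k * y (suc zero) - (- B) ^ k * y (fromℕ (suc k)))
          + B * A ^ k * y (suc zero)
      ≡⟨ cancel A B (A ^ k) (y zero) (y (suc zero)) ((- B) ^ k) (y (fromℕ (suc k))) ⟩
        A * A ^ k * y zero - (- B) * (- B) ^ k * y (fromℕ (suc k)) ∎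
      where
      open ≡-Reasoning
      X Y : ℤ
      X = P k (λ i → y (suc (inject₁ i)))
      Y = P k (λ i → y (suc (suc i)))
      regroup : ∀ A B Aᵏ y₀ y₁ X Y →
        A * (Aᵏ * y₀ + (- B) * X) + B * (Aᵏ * y₁ + (- B) * Y)
          ≡ A * Aᵏ * y₀ + (- B) * (A * X + B * Y) + B * Aᵏ * y₁
      regroup = solve-∀
      cancel : ∀ A B Aᵏ y₀ y₁ Bᵏ yₗ →
        A * Aᵏ * y₀ + (- B) * (Aᵏ * y₁ - Bᵏ * yₗ) + B * Aᵏ * y₁ ≡ A * Aᵏ * y₀ - (- B) * Bᵏ * yₗ
      cancel = solve-∀

  carry-elimination : ∀ A B D N w S₁ S₂ q₁ q₂ r₁ r₂ Q →
    A * S₁ + B * S₂ ≡ N * (w + D) + Q → S₁ ≡ r₁ + q₁ * N → S₂ ≡ r₂ + q₂ * N →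
    N * (w - A * q₁ - B * q₂ + D) ≡ A * r₁ + B * r₂ - Q
  carry-elimination A B D N w S₁ S₂ q₁ q₂ r₁ r₂ Q total refl refl = begin
      N * (w - A * q₁ - B * q₂ + D)
    ≡⟨ expand N w D A B q₁ q₂ Q ⟩
      (N * (w + D) + Q) - Q - N * (A * q₁ + B * q₂)
    ≡⟨ cong (λ e → e - Q - N * (A * q₁ + B * q₂)) (sym total) ⟩
      (A * (r₁ + q₁ * N) + B * (r₂ + q₂ * N)) - Q - N * (A * q₁ + B * q₂)
    ≡⟨ collect A B N q₁ q₂ r₁ r₂ Q ⟩
      A * r₁ + B * r₂ - Q ∎
    where
    open ≡-Reasoning
    expand : ∀ N w D A B q₁ q₂ Q →
      N * (w - A * q₁ - B * q₂ + D) ≡ (N * (w + D) + Q) - Q - N * (A * q₁ + B * q₂)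
    expand = solve-∀
    collect : ∀ A B N q₁ q₂ r₁ r₂ Q →
      (A * (r₁ + q₁ * N) + B * (r₂ + q₂ * N)) - Q - N * (A * q₁ + B * q₂) ≡ A * r₁ + B * r₂ - Q
    collect = solve-∀

  -- If N·X = a·r₁ + b·r₂ − Q with r₁, r₂, Q < N, then 0 ≤ X < a + b: the
  -- left side lies strictly between −N and (a + b)·N.
  quotient-bounds : ∀ (N a b r₁ r₂ Q : ℕ) (X : ℤ) .{{_ : NonZero a}} →
    r₁ ℕ.< N → r₂ ℕ.< N → Q ℕ.< N →
    + N * X ≡ + a * + r₁ + + b * + r₂ - + Q → (+ 0 ≤ X) × (X < + (a ℕ.+ b))
  quotient-bounds N a b r₁ r₂ Q X r₁<N r₂<N Q<N eq =
    ℤP.i<j⇒suc[i]≤j (ℤP.*-cancelˡ-<-nonNeg (+ N) lower) , ℤP.*-cancelˡ-<-nonNeg (+ N) upper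
    where
    open ℤP.≤-Reasoning
    R : ℕ
    R = a ℕ.* r₁ ℕ.+ b ℕ.* r₂
    R≡ : + R ≡ + a * + r₁ + + b * + r₂
    R≡ = trans (ℤP.pos-+ (a ℕ.* r₁) (b ℕ.* r₂)) (cong₂ _+_ (ℤP.pos-* a r₁) (ℤP.pos-* b r₂))
    R< : R ℕ.< N ℕ.* (a ℕ.+ b)
    R< = ℕP.<-≤-trans (ℕP.+-mono-<-≤ (ℕP.*-monoʳ-< a r₁<N) (ℕP.*-monoʳ-≤ b (ℕP.<⇒≤ r₂<N)))
           (ℕP.≤-reflexive (trans (sym (ℕP.*-distribʳ-+ N a b)) (ℕP.*-comm (a ℕ.+ b) N)))
    upper : + N * X < + N * + (a ℕ.+ b)
    upper = begin-strict
      + N * X          ≡⟨ trans eq (cong (_- + Q) (sym R≡)) ⟩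
      + R - + Q        ≤⟨ ℤP.i-j≤i (+ R) (+ Q) ⟩
      + R              <⟨ ℤ.+<+ R< ⟩
      + (N ℕ.* (a ℕ.+ b)) ≡⟨ ℤP.pos-* N (a ℕ.+ b) ⟩
      + N * + (a ℕ.+ b) ∎
    lower : + N * - 1ℤ < + N * X
    lower = begin-strict
      + N * - 1ℤ       ≡⟨ times-minus-one (+ N) ⟩
      - + N            <⟨ ℤP.neg-mono-< (ℤ.+<+ Q<N) ⟩
      - + Q            ≡⟨ ℤP.+-identityˡ (- + Q) ⟨
      + 0 - + Q        ≤⟨ ℤP.+-monoˡ-≤ (- + Q) (ℤ.+≤+ ℕ.z≤n) ⟩
      + R - + Q        ≡⟨ trans (cong (_- + Q) R≡) (sym eq) ⟩
      + N * X ∎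
      where
      times-minus-one : ∀ x → x * - 1ℤ ≡ - x
      times-minus-one = solve-∀

  shift-interval : ∀ K d x → + 0 ≤ x + + d → x + + d < + suc K → (- + d ≤ x) × (x ≤ + K - + d)
  shift-interval K d x 0≤x+d x+d<1+K =
    subst₂ _≤_ (ℤP.+-identityˡ (- + d)) (unshift x (+ d)) (ℤP.+-monoˡ-≤ (- + d) 0≤x+d) ,
    subst (_≤ + K - + d) (unshift x (+ d)) (ℤP.+-monoˡ-≤ (- + d) (ℤP.i<j⇒i≤pred[j] x+d<1+K))
    where
    unshift : ∀ x d → x + d - d ≡ x
    unshift = solve-∀

  module Carry (a₁ b₁ d m : ℕ) where

    a b n K W N : ℕ
    a = suc a₁
    b = suc b₁
    n = suc (m ℕ.+ m)
    K = a ℕ.+ b ℕ.∸ 1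
    W = K ℕ.+ K
    N = (a ℕ.+ b) ℕ.* a ℕ.^ n

    A B C D : ℤ
    A = + a
    B = + b
    C = A + B
    D = + d

    instance
      N≢0 : NonZero N
      N≢0 = ℕP.m*n≢0 (a ℕ.+ b) (a ℕ.^ n) {{_}} {{ℕP.m^n≢0 a n}}

    open WindowPolynomial A B

    -- S(y); the shift −d·aⁿ centres the digit interval of the output.
    numerator : (Fin n → ℤ) → ℤ
    numerator y = - D * A ^ n + C * P n (λ i → y i + (D + D))

    carry : (Fin n → ℤ) → ℤ
    carry y = numerator y /ℕ N

    carry-cong : ∀ {y y′ : Fin n → ℤ} → (∀ i → y i ≡ y′ i) → carry y ≡ carry y′
    carry-cong eq = cong (λ e → (- D * A ^ n + C * e) /ℕ N) (P-cong n (λ i → cong (_+ (D + D)) (eq i)))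

    Φ : (Fin (suc n) → ℤ) → ℤ
    Φ w = w zero - A * carry (w ∘ inject₁) - B * carry (w ∘ suc)

    N≡ : + N ≡ C * A ^ n
    N≡ = trans (ℤP.pos-* (a ℕ.+ b) (a ℕ.^ n)) (cong (C *_) (pos-^ a n))

    -- The numerators of two overlapping windows combine, by the shift identity
    -- (n odd), into N·(w₀ + d) plus a nonnegative multiple of the last entry.
    numerator-identity : ∀ (w : Fin (suc n) → ℤ) →
      A * numerator (w ∘ inject₁) + B * numerator (w ∘ suc)
        ≡ + N * (w zero + D) + C * B ^ n * (w (fromℕ n) + (D + D))
    numerator-identity w = begin
        A * (- D * A ^ n + C * P n (y ∘ inject₁)) + B * (- D * A ^ n + C * P n (y ∘ suc))
      ≡⟨ factor A B D (A ^ n) (P n (y ∘ inject₁)) (P n (y ∘ suc)) ⟩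
        C * (A * P n (y ∘ inject₁) + B * P n (y ∘ suc)) - C * D * A ^ n
      ≡⟨ cong (λ e → C * e - C * D * A ^ n) (P-shift n y) ⟩
        C * (A ^ n * y zero - (- B) ^ n * y (fromℕ n)) - C * D * A ^ n
      ≡⟨ cong (λ e → C * (A ^ n * y zero - e * y (fromℕ n)) - C * D * A ^ n) (neg-^-odd B m) ⟩
        C * (A ^ n * y zero - (- B ^ n) * y (fromℕ n)) - C * D * A ^ n
      ≡⟨ simplify C D (A ^ n) (B ^ n) (w zero) (y (fromℕ n)) ⟩
        C * A ^ n * (w zero + D) + C * B ^ n * y (fromℕ n)
      ≡⟨ cong (λ e → e * (w zero + D) + C * B ^ n * y (fromℕ n)) (sym N≡) ⟩
        + N * (w zero + D) + C * B ^ n * y (fromℕ n) ∎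
      where
      open ≡-Reasoning
      y : Fin (suc n) → ℤ
      y i = w i + (D + D)
      factor : ∀ A B D Aⁿ P₁ P₂ →
        A * (- D * Aⁿ + (A + B) * P₁) + B * (- D * Aⁿ + (A + B) * P₂) ≡ (A + B) * (A * P₁ + B * P₂) - (A + B) * D * Aⁿ
      factor = solve-∀
      simplify : ∀ C D Aⁿ Bⁿ w₀ yₙ →
        C * (Aⁿ * (w₀ + (D + D)) - (- Bⁿ) * yₙ) - C * D * Aⁿ ≡ C * Aⁿ * (w₀ + D) + C * Bⁿ * yₙ
      simplify = solve-∀

    Φ-digit : W ℕ.* b ℕ.^ n ℕ.< a ℕ.^ n → ∀ (w : Fin (suc n) → ℤ) k →
      w (fromℕ n) + (D + D) ≡ + k → k ℕ.≤ W → 𝒜[ a , b , d ] (Φ w)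
    Φ-digit Wbⁿ<aⁿ w k yₙ≡k k≤W = uncurry (shift-interval K d (Φ w))
      (quotient-bounds N a b (S₁ %ℕ N) (S₂ %ℕ N) q (Φ w + D) (n%ℕd<d S₁ N) (n%ℕd<d S₂ N) q<N eliminated)
      where
      S₁ S₂ : ℤ
      S₁ = numerator (w ∘ inject₁)
      S₂ = numerator (w ∘ suc)
      q : ℕ
      q = (a ℕ.+ b) ℕ.* (b ℕ.^ n ℕ.* k)
      q≡ : C * B ^ n * (w (fromℕ n) + (D + D)) ≡ + q
      q≡ = begin
          C * B ^ n * (w (fromℕ n) + (D + D))
        ≡⟨ cong₂ (λ s t → C * s * t) (sym (pos-^ b n)) yₙ≡k ⟩
          C * + (b ℕ.^ n) * + k
        ≡⟨ ℤP.*-assoc C (+ (b ℕ.^ n)) (+ k) ⟩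
          C * (+ (b ℕ.^ n) * + k)
        ≡⟨ cong (C *_) (sym (ℤP.pos-* (b ℕ.^ n) k)) ⟩
          C * + (b ℕ.^ n ℕ.* k)
        ≡⟨ sym (ℤP.pos-* (a ℕ.+ b) (b ℕ.^ n ℕ.* k)) ⟩
          + q ∎
        where open ≡-Reasoning
      q<N : q ℕ.< N
      q<N = ℕP.*-monoʳ-< (a ℕ.+ b)
        (ℕP.≤-<-trans (ℕP.≤-trans (ℕP.≤-reflexive (ℕP.*-comm (b ℕ.^ n) k)) (ℕP.*-monoˡ-≤ (b ℕ.^ n) k≤W))
                      Wbⁿ<aⁿ)
      eliminated : + N * (Φ w + D) ≡ A * + (S₁ %ℕ N) + B * + (S₂ %ℕ N) - + q
      eliminated = carry-elimination A B D (+ N) (w zero) S₁ S₂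
        (S₁ /ℕ N) (S₂ /ℕ N) (+ (S₁ %ℕ N)) (+ (S₂ %ℕ N)) (+ q)
        (trans (numerator-identity w) (cong (λ e → + N * (w zero + D) + e) q≡))
        (a≡a%ℕn+[a/ℕn]*n S₁ N) (a≡a%ℕn+[a/ℕn]*n S₂ N)

    -- The all-zero window has carry zero (using d < a + b and W·bⁿ < aⁿ), so
    -- the conversion maps finitely supported inputs to finitely supported outputs.
    carry-zero : d ℕ.< a ℕ.+ b → W ℕ.* b ℕ.^ n ℕ.< a ℕ.^ n → carry (λ _ → 0ℤ) ≡ 0ℤ
    carry-zero d<a+b Wbⁿ<aⁿ = trans (cong (_/ℕ N) numerator-zero) (cong +_ (m<n⇒m/n≡0 s<N))
      where
      s : ℕ
      s = d ℕ.* a ℕ.^ n ℕ.+ (d ℕ.+ d) ℕ.* b ℕ.^ n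
      d≤K : d ℕ.≤ K
      d≤K = ℕP.≤-pred d<a+b
      s<N : s ℕ.< N
      s<N = subst (s ℕ.<_) (ℕP.+-comm (K ℕ.* a ℕ.^ n) (a ℕ.^ n))
        (ℕP.+-mono-≤-< (ℕP.*-monoˡ-≤ (a ℕ.^ n) d≤K)
          (ℕP.≤-<-trans (ℕP.*-monoˡ-≤ (b ℕ.^ n) (ℕP.+-mono-≤ d≤K d≤K)) Wbⁿ<aⁿ))
      c : ℤ
      c = 0ℤ + (D + D)
      numerator-zero : numerator (λ _ → 0ℤ) ≡ + s
      numerator-zero = begin
          - D * A ^ n + C * P n (λ _ → c)
        ≡⟨ cong (λ e → - D * A ^ n + e) (ℤP.*-distribʳ-+ (P n (λ _ → c)) A B) ⟩
          - D * A ^ n + (A * P n (λ _ → c) + B * P n (λ _ → c))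
        ≡⟨ cong (λ e → - D * A ^ n + e) (P-shift n (λ _ → c)) ⟩
          - D * A ^ n + (A ^ n * c - (- B) ^ n * c)
        ≡⟨ cong (λ e → - D * A ^ n + (A ^ n * c - e * c)) (neg-^-odd B m) ⟩
          - D * A ^ n + (A ^ n * c - (- B ^ n) * c)
        ≡⟨ simplify D (A ^ n) (B ^ n) ⟩
          D * A ^ n + (D + D) * B ^ n
        ≡⟨ cong₂ _+_ (cong (D *_) (sym (pos-^ a n))) (cong₂ _*_ (sym (ℤP.pos-+ d d)) (sym (pos-^ b n))) ⟩
          D * + (a ℕ.^ n) + + (d ℕ.+ d) * + (b ℕ.^ n)
        ≡⟨ sym (trans (ℤP.pos-+ (d ℕ.* a ℕ.^ n) ((d ℕ.+ d) ℕ.* b ℕ.^ n))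
                      (cong₂ _+_ (ℤP.pos-* d (a ℕ.^ n)) (ℤP.pos-* (d ℕ.+ d) (b ℕ.^ n)))) ⟩
          + s ∎
        where
        open ≡-Reasoning
        simplify : ∀ D Aⁿ Bⁿ →
          - D * Aⁿ + (Aⁿ * (0ℤ + (D + D)) - (- Bⁿ) * (0ℤ + (D + D))) ≡ D * Aⁿ + (D + D) * Bⁿ
        simplify = solve-∀

module Fractions where

  open import Algebra.Core using (Op₂)
  open import Data.Nat as ℕ using (ℕ; zero; suc; NonZero)
  import Data.Nat.Properties as ℕP
  open import Data.Integer as ℤ using (ℤ; +_; -[1+_]; 1ℤ)
  import Data.Integer.Properties as ℤP
  open import Data.Integer.Tactic.RingSolver using (solve-∀)
  open import Data.Rational as ℚ using (ℚ; _/_; toℚᵘ; fromℚᵘ)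
  import Data.Rational.Properties as ℚP
  open import Data.Rational.Unnormalised as ℚᵘ using (ℚᵘ; mkℚᵘ; *≡*) renaming (_≃_ to _≃ᵘ_)
  import Data.Rational.Unnormalised.Properties as ℚᵘP
  open import Relation.Binary.PropositionalEquality
  open import Defs using (βpow)

  -- fromℚᵘ inverts toℚᵘ up to ≃, so it carries every operation that toℚᵘ
  -- preserves: computations with fractions can be done on unnormalised ones.
  fromℚᵘ-homo₂ : ∀ (_∙_ : Op₂ ℚ) (_∙ᵘ_ : Op₂ ℚᵘ) →
    (∀ p q → toℚᵘ (p ∙ q) ≃ᵘ toℚᵘ p ∙ᵘ toℚᵘ q) →
    (∀ {p p′ q q′} → p ≃ᵘ p′ → q ≃ᵘ q′ → p ∙ᵘ q ≃ᵘ p′ ∙ᵘ q′) →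
    ∀ p q → fromℚᵘ (p ∙ᵘ q) ≡ fromℚᵘ p ∙ fromℚᵘ q
  fromℚᵘ-homo₂ _∙_ _∙ᵘ_ homo ∙-cong p q = ℚP.toℚᵘ-injective (begin-equality
      toℚᵘ (fromℚᵘ (p ∙ᵘ q))              ≃⟨ ℚP.toℚᵘ-fromℚᵘ (p ∙ᵘ q) ⟩
      p ∙ᵘ q                              ≃⟨ ∙-cong (back p) (back q) ⟩
      toℚᵘ (fromℚᵘ p) ∙ᵘ toℚᵘ (fromℚᵘ q)  ≃⟨ ℚᵘP.≃-sym (homo (fromℚᵘ p) (fromℚᵘ q)) ⟩
      toℚᵘ (fromℚᵘ p ∙ fromℚᵘ q)          ∎)
    where
    open ℚᵘP.≤-Reasoning
    back : ∀ r → r ≃ᵘ toℚᵘ (fromℚᵘ r)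
    back r = ℚᵘP.≃-sym (ℚP.toℚᵘ-fromℚᵘ r)

  fromℚᵘ-homo-+ : ∀ p q → fromℚᵘ (p ℚᵘ.+ q) ≡ fromℚᵘ p ℚ.+ fromℚᵘ q
  fromℚᵘ-homo-+ = fromℚᵘ-homo₂ ℚ._+_ ℚᵘ._+_ ℚP.toℚᵘ-homo-+ ℚᵘP.+-cong

  fromℚᵘ-homo-* : ∀ p q → fromℚᵘ (p ℚᵘ.* q) ≡ fromℚᵘ p ℚ.* fromℚᵘ q
  fromℚᵘ-homo-* = fromℚᵘ-homo₂ ℚ._*_ ℚᵘ._*_ ℚP.toℚᵘ-homo-* ℚᵘP.*-cong

  fromℚᵘ-homo-neg : ∀ p → fromℚᵘ (ℚᵘ.- p) ≡ ℚ.- fromℚᵘ p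
  fromℚᵘ-homo-neg p = ℚP.toℚᵘ-injective (begin-equality
      toℚᵘ (fromℚᵘ (ℚᵘ.- p))    ≃⟨ ℚP.toℚᵘ-fromℚᵘ (ℚᵘ.- p) ⟩
      ℚᵘ.- p                    ≃⟨ ℚᵘP.-‿cong (ℚᵘP.≃-sym (ℚP.toℚᵘ-fromℚᵘ p)) ⟩
      ℚᵘ.- toℚᵘ (fromℚᵘ p)      ≃⟨ ℚᵘP.≃-sym (ℚP.toℚᵘ-homo‿- (fromℚᵘ p)) ⟩
      toℚᵘ (ℚ.- fromℚᵘ p)       ∎)
    where open ℚᵘP.≤-Reasoning

  /-cross : ∀ x y m n .{{_ : NonZero m}} .{{_ : NonZero n}} →
    x ℤ.* + n ≡ y ℤ.* + m → x / m ≡ y / n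
  /-cross x y (suc m) (suc n) eq = ℚP.fromℚᵘ-cong {mkℚᵘ x m} {mkℚᵘ y n} (*≡* eq)

  neg-/ : ∀ x m .{{_ : NonZero m}} → ℚ.- (x / m) ≡ ℤ.- x / m
  neg-/ x (suc m) = sym (fromℚᵘ-homo-neg (mkℚᵘ x m))

  ι : ℤ → ℚ
  ι x = x / 1

  ι-*-/ : ∀ c x m .{{_ : NonZero m}} → ι c ℚ.* (x / m) ≡ (c ℤ.* x) / m
  ι-*-/ c x (suc m) = sym (trans
    (ℚP.fromℚᵘ-cong {mkℚᵘ (c ℤ.* x) m} {mkℚᵘ c 0 ℚᵘ.* mkℚᵘ x m}
      (*≡* (cong (λ k → c ℤ.* x ℤ.* + suc k) (ℕP.+-identityʳ m))))
    (fromℚᵘ-homo-* (mkℚᵘ c 0) (mkℚᵘ x m)))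

  ι-+ : ∀ x y → ι (x ℤ.+ y) ≡ ι x ℚ.+ ι y
  ι-+ x y = trans
    (ℚP.fromℚᵘ-cong {mkℚᵘ (x ℤ.+ y) 0} {mkℚᵘ x 0 ℚᵘ.+ mkℚᵘ y 0} (*≡* (over-one x y)))
    (fromℚᵘ-homo-+ (mkℚᵘ x 0) (mkℚᵘ y 0))
    where
    over-one : ∀ x y → (x ℤ.+ y) ℤ.* + 1 ≡ (x ℤ.* + 1 ℤ.+ y ℤ.* + 1) ℤ.* + 1
    over-one = solve-∀

  ι-* : ∀ x y → ι (x ℤ.* y) ≡ ι x ℚ.* ι y
  ι-* x y = sym (ι-*-/ x y 1)

  ι-neg : ∀ x → ι (ℤ.- x) ≡ ℚ.- ι x
  ι-neg x = sym (neg-/ x 1)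

  ι-- : ∀ x y → ι (x ℤ.- y) ≡ ι x ℚ.- ι y
  ι-- x y = trans (ι-+ x (ℤ.- y)) (cong (ι x ℚ.+_) (ι-neg y))

  module BaseRelation (a b : ℕ) .{{_ : NonZero a}} .{{_ : NonZero b}} where

    A B : ℤ
    A = + a
    B = + b

    pow : ℤ → ℚ
    pow = βpow a b

    scaled : ∀ x y m n .{{_ : NonZero m}} .{{_ : NonZero n}} →
      B ℤ.* x ℤ.* + n ≡ ℤ.- (A ℤ.* y) ℤ.* + m → ι B ℚ.* (x / m) ≡ ℚ.- (ι A ℚ.* (y / n))
    scaled x y m n eq = begin
      ι B ℚ.* (x / m)         ≡⟨ ι-*-/ B x m ⟩
      (B ℤ.* x) / m           ≡⟨ /-cross (B ℤ.* x) (ℤ.- (A ℤ.* y)) m n eq ⟩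
      ℤ.- (A ℤ.* y) / n       ≡⟨ neg-/ (A ℤ.* y) n ⟨
      ℚ.- ((A ℤ.* y) / n)     ≡⟨ cong ℚ.-_ (ι-*-/ A y n) ⟨
      ℚ.- (ι A ℚ.* (y / n))   ∎
      where open ≡-Reasoning

    βpow-step : ∀ j → ι B ℚ.* pow (j ℤ.+ 1ℤ) ≡ ℚ.- (ι A ℚ.* pow j)
    βpow-step (+ k) rewrite ℕP.+-comm k 1 =
      scaled _ _ (b ℕ.^ suc k) (b ℕ.^ k) {{ℕP.m^n≢0 b (suc k)}} {{ℕP.m^n≢0 b k}}
        (trans (cross A B ((ℤ.- A) ℤ.^ k) (+ (b ℕ.^ k)))
               (cong (ℤ.- (A ℤ.* (ℤ.- A) ℤ.^ k) ℤ.*_) (sym (ℤP.pos-* b (b ℕ.^ k)))))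
      where
      cross : ∀ A B X Y → B ℤ.* ((ℤ.- A) ℤ.* X) ℤ.* Y ≡ ℤ.- (A ℤ.* X) ℤ.* (B ℤ.* Y)
      cross = solve-∀
    βpow-step -[1+ zero ] =
      scaled _ _ 1 (a ℕ.^ 1) {{_}} {{ℕP.m^n≢0 a 1}} (trans (cong (B ℤ.* 1ℤ ℤ.*_) (ℤP.pos-* a 1)) (cross A B))
      where
      cross : ∀ A B → B ℤ.* 1ℤ ℤ.* (A ℤ.* 1ℤ) ≡ ℤ.- (A ℤ.* ((ℤ.- B) ℤ.* 1ℤ)) ℤ.* 1ℤ
      cross = solve-∀
    βpow-step -[1+ suc k ] =
      scaled _ _ (a ℕ.^ suc k) (a ℕ.^ suc (suc k)) {{ℕP.m^n≢0 a (suc k)}} {{ℕP.m^n≢0 a (suc (suc k))}}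
        (trans (cong (B ℤ.* (ℤ.- B) ℤ.^ suc k ℤ.*_) (ℤP.pos-* a (a ℕ.^ suc k)))
               (cross A B ((ℤ.- B) ℤ.^ suc k) (+ (a ℕ.^ suc k))))
      where
      cross : ∀ A B X Y → B ℤ.* X ℤ.* (A ℤ.* Y) ≡ ℤ.- (A ℤ.* ((ℤ.- B) ℤ.* X)) ℤ.* Y
      cross = solve-∀

module FiniteSums where

  open import Data.Nat as ℕ using (ℕ; zero; suc)
  import Data.Nat.Properties as ℕP
  open import Data.Integer as ℤ using (ℤ; +_; ∣_∣)
  import Data.Integer.Properties as ℤP
  open import Data.Integer.Tactic.RingSolver using (solve-∀)
  import Data.Nat.Tactic.RingSolver as ℕ-Ring
  open import Data.Rational as ℚ using (ℚ; 0ℚ; _+_; _-_)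
  import Data.Rational.Properties as ℚP
  open import Data.Rational.Solver using (module +-*-Solver)
  open import Relation.Binary.PropositionalEquality
  open import Defs using (sumFrom; sumSym)

  open +-*-Solver using (solve; _:+_; _:-_; _:=_)

  sum-cong : ∀ lo n {f g : ℤ → ℚ} → (∀ j → f j ≡ g j) → sumFrom lo n f ≡ sumFrom lo n g
  sum-cong lo zero    eq = refl
  sum-cong lo (suc n) eq = cong₂ _+_ (eq lo) (sum-cong (lo ℤ.+ + 1) n eq)

  sum-sub : ∀ lo n (f g : ℤ → ℚ) → sumFrom lo n (λ j → f j - g j) ≡ sumFrom lo n f - sumFrom lo n g
  sum-sub lo zero    f g = sym (ℚP.+-inverseʳ 0ℚ)
  sum-sub lo (suc n) f g =
    trans (cong (_+_ (f lo - g lo)) (sum-sub (lo ℤ.+ + 1) n f g))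
          (interchange (f lo) (g lo) (sumFrom (lo ℤ.+ + 1) n f) (sumFrom (lo ℤ.+ + 1) n g))
    where
    interchange : ∀ a b c d → (a - b) + (c - d) ≡ (a + c) - (b + d)
    interchange = solve 4 (λ a b c d → (a :- b) :+ (c :- d) := (a :+ c) :- (b :+ d)) refl

  sum-telescope : ∀ lo n (H : ℤ → ℚ) →
    sumFrom lo n (λ j → H (j ℤ.+ + 1) - H j) ≡ H (lo ℤ.+ + n) - H lo
  sum-telescope lo zero    H = trans (sym (ℚP.+-inverseʳ (H lo))) (cong (λ i → H i - H lo) (sym (ℤP.+-identityʳ lo)))
  sum-telescope lo (suc n) H = begin
      (H (lo ℤ.+ + 1) - H lo) + sumFrom (lo ℤ.+ + 1) n (λ j → H (j ℤ.+ + 1) - H j)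
    ≡⟨ cong (_+_ (H (lo ℤ.+ + 1) - H lo)) (sum-telescope (lo ℤ.+ + 1) n H) ⟩
      (H (lo ℤ.+ + 1) - H lo) + (H (lo ℤ.+ + 1 ℤ.+ + n) - H (lo ℤ.+ + 1))
    ≡⟨ collapse (H (lo ℤ.+ + 1)) (H lo) (H (lo ℤ.+ + 1 ℤ.+ + n)) ⟩
      H (lo ℤ.+ + 1 ℤ.+ + n) - H lo
    ≡⟨ cong (λ i → H i - H lo) (ℤP.+-assoc lo (+ 1) (+ n)) ⟩
      H (lo ℤ.+ + suc n) - H lo ∎
    where
    open ≡-Reasoning
    collapse : ∀ x y z → (x - y) + (z - x) ≡ z - y
    collapse = solve 3 (λ x y z → (x :- y) :+ (z :- x) := z :- y) refl

  sum-split : ∀ lo m k (f : ℤ → ℚ) →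
    sumFrom lo (m ℕ.+ k) f ≡ sumFrom lo m f + sumFrom (lo ℤ.+ + m) k f
  sum-split lo zero    k f = trans (cong (λ i → sumFrom i k f) (sym (ℤP.+-identityʳ lo))) (sym (ℚP.+-identityˡ _))
  sum-split lo (suc m) k f = begin
      f lo + sumFrom (lo ℤ.+ + 1) (m ℕ.+ k) f
    ≡⟨ cong (_+_ (f lo)) (sum-split (lo ℤ.+ + 1) m k f) ⟩
      f lo + (sumFrom (lo ℤ.+ + 1) m f + sumFrom (lo ℤ.+ + 1 ℤ.+ + m) k f)
    ≡⟨ sym (ℚP.+-assoc (f lo) _ _) ⟩
      (f lo + sumFrom (lo ℤ.+ + 1) m f) + sumFrom (lo ℤ.+ + 1 ℤ.+ + m) k f
    ≡⟨ cong (λ i → (f lo + sumFrom (lo ℤ.+ + 1) m f) + sumFrom i k f) (ℤP.+-assoc lo (+ 1) (+ m)) ⟩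
      (f lo + sumFrom (lo ℤ.+ + 1) m f) + sumFrom (lo ℤ.+ + suc m) k f ∎
    where open ≡-Reasoning

  sum-vanish : ∀ lo n (f : ℤ → ℚ) → (∀ i → i ℕ.< n → f (lo ℤ.+ + i) ≡ 0ℚ) → sumFrom lo n f ≡ 0ℚ
  sum-vanish lo zero    f zeros = refl
  sum-vanish lo (suc n) f zeros = trans
    (cong₂ _+_ (trans (cong f (sym (ℤP.+-identityʳ lo))) (zeros 0 (ℕ.s≤s ℕ.z≤n)))
               (sum-vanish (lo ℤ.+ + 1) n f λ i i<n → trans (cong f (ℤP.+-assoc lo (+ 1) (+ i))) (zeros (suc i) (ℕ.s≤s i<n))))
    (ℚP.+-identityˡ 0ℚ)

  ∣j∣≤∣j-k∣+k : ∀ j k → ∣ j ∣ ℕ.≤ ∣ j ℤ.- + k ∣ ℕ.+ k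
  ∣j∣≤∣j-k∣+k j k =
    subst (λ i → ∣ i ∣ ℕ.≤ ∣ j ℤ.- + k ∣ ℕ.+ k) (restore j (+ k)) (ℤP.∣i+j∣≤∣i∣+∣j∣ (j ℤ.- + k) (+ k))
    where
    restore : ∀ j k → j ℤ.- k ℤ.+ k ≡ j
    restore = solve-∀

  outside-shift : ∀ N k j → N ℕ.+ k ℕ.< ∣ j ∣ → N ℕ.< ∣ j ℤ.- + k ∣
  outside-shift N k j N+k<∣j∣ = ℕP.+-cancelʳ-< k N ∣ j ℤ.- + k ∣ (ℕP.<-≤-trans N+k<∣j∣ (∣j∣≤∣j-k∣+k j k))

  past-top : ∀ N → ℤ.- + N ℤ.+ + suc (2 ℕ.* N) ≡ + suc N
  past-top N = begin
      ℤ.- + N ℤ.+ + suc (2 ℕ.* N)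
    ≡⟨ cong (ℤ._+_ (ℤ.- + N)) (trans (ℤP.pos-+ 1 (2 ℕ.* N)) (cong (ℤ._+_ (+ 1)) (ℤP.pos-* 2 N))) ⟩
      ℤ.- + N ℤ.+ (+ 1 ℤ.+ + 2 ℤ.* + N)
    ≡⟨ recentre (+ N) ⟩
      + 1 ℤ.+ + N
    ≡⟨ sym (ℤP.pos-+ 1 N) ⟩
      + suc N ∎
    where
    open ≡-Reasoning
    recentre : ∀ n → ℤ.- n ℤ.+ (+ 1 ℤ.+ + 2 ℤ.* n) ≡ + 1 ℤ.+ n
    recentre = solve-∀

  sumSym-extend : ∀ N k (f : ℤ → ℚ) → (∀ j → N ℕ.< ∣ j ∣ → f j ≡ 0ℚ) → sumSym (N ℕ.+ k) f ≡ sumSym N f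
  sumSym-extend N k f outside = begin
      sumFrom lo (suc (2 ℕ.* (N ℕ.+ k))) f
    ≡⟨ cong (λ L → sumFrom lo L f) (lengths N k) ⟩
      sumFrom lo (k ℕ.+ (L ℕ.+ k)) f
    ≡⟨ sum-split lo k (L ℕ.+ k) f ⟩
      sumFrom lo k f + sumFrom (lo ℤ.+ + k) (L ℕ.+ k) f
    ≡⟨ cong₂ _+_ (sum-vanish lo k f left) (cong (λ i → sumFrom i (L ℕ.+ k) f) (start (+ N) (+ k))) ⟩
      0ℚ + sumFrom (ℤ.- + N) (L ℕ.+ k) f
    ≡⟨ trans (ℚP.+-identityˡ _) (sum-split (ℤ.- + N) L k f) ⟩
      sumSym N f + sumFrom (ℤ.- + N ℤ.+ + L) k f
    ≡⟨ cong (_+_ (sumSym N f)) (sum-vanish (ℤ.- + N ℤ.+ + L) k f right) ⟩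
      sumSym N f + 0ℚ
    ≡⟨ ℚP.+-identityʳ (sumSym N f) ⟩
      sumSym N f ∎
    where
    open ≡-Reasoning
    lo : ℤ
    lo = ℤ.- + (N ℕ.+ k)
    L : ℕ
    L = suc (2 ℕ.* N)
    lengths : ∀ N k → suc (2 ℕ.* (N ℕ.+ k)) ≡ k ℕ.+ (suc (2 ℕ.* N) ℕ.+ k)
    lengths = ℕ-Ring.solve-∀
    start : ∀ N k → ℤ.- (N ℤ.+ k) ℤ.+ k ≡ ℤ.- N
    start = solve-∀
    left : ∀ i → i ℕ.< k → f (lo ℤ.+ + i) ≡ 0ℚ
    left i i<k = outside _ (subst (N ℕ.<_) (sym ∣lo+i∣) (outside-shift N i (+ (N ℕ.+ k)) (ℕP.+-monoʳ-< N i<k)))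
      where
      ∣lo+i∣ : ∣ lo ℤ.+ + i ∣ ≡ ∣ + (N ℕ.+ k) ℤ.- + i ∣
      ∣lo+i∣ = trans (cong ∣_∣ (flip (+ (N ℕ.+ k)) (+ i))) (ℤP.∣-i∣≡∣i∣ (+ (N ℕ.+ k) ℤ.- + i))
        where
        flip : ∀ x y → ℤ.- x ℤ.+ y ≡ ℤ.- (x ℤ.- y)
        flip = solve-∀
    right : ∀ i → i ℕ.< k → f (ℤ.- + N ℤ.+ + L ℤ.+ + i) ≡ 0ℚ
    right i _ = outside _ (subst (N ℕ.<_) (cong (λ e → ∣ e ℤ.+ + i ∣) (sym (past-top N))) (ℕ.s≤s (ℕP.m≤m+n N i)))

module WindowLength where

  open import Data.Nat using (ℕ; zero; suc; _+_; _*_; _^_; _≤_; _<_; s≤s)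
  import Data.Nat.Properties as ℕP
  open import Data.Nat.Tactic.RingSolver using (solve-∀)
  open import Data.Product using (∃-syntax; _,_)
  open import Relation.Binary.PropositionalEquality

  bernoulli : ∀ a b → b < a → ∀ k → b ^ k * (b + k) ≤ b * a ^ k
  bernoulli a b b<a zero = ℕP.≤-reflexive (base b)
    where
    base : ∀ b → 1 * (b + 0) ≡ b * 1
    base = solve-∀
  bernoulli a b b<a (suc k) = begin
      b * b ^ k * (b + suc k)
    ≡⟨ expand b (b ^ k) k ⟩
      b * (b ^ k * (b + k)) + b * b ^ k
    ≤⟨ ℕP.+-mono-≤ (ℕP.*-monoʳ-≤ b (bernoulli a b b<a k)) (ℕP.*-monoʳ-≤ b (ℕP.^-monoˡ-≤ k (ℕP.<⇒≤ b<a))) ⟩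
      b * (b * a ^ k) + b * a ^ k
    ≡⟨ collect b (a ^ k) ⟩
      b * (suc b * a ^ k)
    ≤⟨ ℕP.*-monoʳ-≤ b (ℕP.*-monoˡ-≤ (a ^ k) b<a) ⟩
      b * (a * a ^ k) ∎
    where
    open ℕP.≤-Reasoning
    expand : ∀ b X k → b * X * (b + suc k) ≡ b * (X * (b + k)) + b * X
    expand = solve-∀
    collect : ∀ b Y → b * (b * Y) + b * Y ≡ b * (suc b * Y)
    collect = solve-∀

  -- For 1 ≤ b < a, some odd power makes aⁿ exceed W·bⁿ (take n = 2bW + 1).
  odd-exponent : ∀ a b W → b < a → 1 ≤ b → ∃[ m ] W * b ^ suc (m + m) < a ^ suc (m + m)
  odd-exponent a b@(suc _) W b<a _ = m , ℕP.*-cancelˡ-< b (W * b ^ n) (a ^ n) scaled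
    where
    m n : ℕ
    m = b * W
    n = suc (m + m)
    bW<b+n : b * W < b + n
    bW<b+n = ℕP.≤-trans (s≤s (ℕP.m≤m+n m m)) (ℕP.m≤n+m n b)
    scaled : b * (W * b ^ n) < b * a ^ n
    scaled = ℕP.<-≤-trans
      (subst (_< b ^ n * (b + n)) (reorder b W (b ^ n)) (ℕP.*-monoʳ-< (b ^ n) {{ℕP.m^n≢0 b n}} bW<b+n))
      (bernoulli a b b<a n)
      where
      reorder : ∀ b W X → X * (b * W) ≡ b * (W * X)
      reorder = solve-∀

module ParallelConverter where

  open import Data.Nat as ℕ using (ℕ; suc)
  import Data.Nat.Properties as ℕP
  open import Data.Integer as ℤ using (ℤ; +_; ∣_∣; 0ℤ)
  import Data.Integer.Properties as ℤP
  open import Data.Integer.Tactic.RingSolver using (solve-∀)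
  open import Data.Rational as ℚ using (ℚ; 0ℚ)
  import Data.Rational.Properties as ℚP
  open import Data.Rational.Solver using (module +-*-Solver)
  open import Data.Fin using (Fin; fromℕ; toℕ)
  open import Data.Fin.Properties using (toℕ-inject₁; toℕ<n)
  open import Data.Product using (∃-syntax; _×_; _,_; map₁; map₂)
  open import Relation.Binary.PropositionalEquality
  open import Defs
  open CarryRule
  open Fractions
  open FiniteSums

  open +-*-Solver using (solve; _:-_; _:*_; :-_; _:=_)

  bounded-natural : ∀ s W → + 0 ℤ.≤ s → s ℤ.≤ + W → ∃[ k ] (s ≡ + k × k ℕ.≤ W)
  bounded-natural (+ k) W _ (ℤ.+≤+ k≤W) = k , refl , k≤W

  module Conversion (a₁ b₁ d m : ℕ) where

    open Carry a₁ b₁ d m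
    open BaseRelation a b using (pow; βpow-step)

    𝒜 : Alphabet
    𝒜 = 𝒜[ a , b , d ]

    q : Seq → ℤ → ℤ
    q u j = carry (λ i → u (j ℤ.- + toℕ i))

    φ : Seq → Seq
    φ u j = Φ (λ i → u (j ℤ.- + toℕ i))

    φ-carries : ∀ u j → φ u j ≡ u j ℤ.- A ℤ.* q u j ℤ.- B ℤ.* q u (j ℤ.- + 1)
    φ-carries u j = cong₃ (λ x y z → x ℤ.- A ℤ.* y ℤ.- B ℤ.* z)
      (cong u (ℤP.+-identityʳ j))
      (carry-cong (λ i → cong (λ t → u (j ℤ.- + t)) (toℕ-inject₁ i)))
      (carry-cong (λ i → cong u (step-back j (+ toℕ i))))
      where
      cong₃ : ∀ {X Y Z R : Set} (f : X → Y → Z → R) {x x′ y y′ z z′} →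
        x ≡ x′ → y ≡ y′ → z ≡ z′ → f x y z ≡ f x′ y′ z′
      cong₃ f refl refl refl = refl
      step-back : ∀ j t → j ℤ.- (+ 1 ℤ.+ t) ≡ j ℤ.- + 1 ℤ.- t
      step-back = solve-∀

    φ-local : Local (suc n) (𝒜 ⊕ 𝒜) φ
    φ-local = n , 0 , trans (cong suc (sym (ℕP.+-identityʳ n))) (ℕP.+-comm 1 (n ℕ.+ 0)) , Φ ,
      λ u _ j → cong (λ k → Φ (λ i → u (k ℤ.- + toℕ i))) (sym (ℤP.+-identityʳ j))

    shifted-sum-digit : ∀ z → (𝒜 ⊕ 𝒜) z → ∃[ k ] (z ℤ.+ (D ℤ.+ D) ≡ + k × k ℕ.≤ W)
    shifted-sum-digit .(x ℤ.+ y) (x , y , x∈𝒜 , y∈𝒜 , refl) =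
      map₂ (map₁ (trans (regroup x y D)))
        (bounded-natural ((x ℤ.+ D) ℤ.+ (y ℤ.+ D)) W
          (ℤP.+-mono-≤ (lower x∈𝒜) (lower y∈𝒜)) (ℤP.+-mono-≤ (upper x∈𝒜) (upper y∈𝒜)))
      where
      regroup : ∀ x y D → x ℤ.+ y ℤ.+ (D ℤ.+ D) ≡ (x ℤ.+ D) ℤ.+ (y ℤ.+ D)
      regroup = solve-∀
      lower : ∀ {x} → 𝒜 x → + 0 ℤ.≤ x ℤ.+ D
      lower {x} (-d≤x , _) = subst (ℤ._≤ x ℤ.+ D) (ℤP.+-inverseˡ D) (ℤP.+-monoˡ-≤ D -d≤x)
      upper : ∀ {x} → 𝒜 x → x ℤ.+ D ℤ.≤ + K
      upper {x} (_ , x≤K-d) = subst (x ℤ.+ D ℤ.≤_) (cancel (+ K) D) (ℤP.+-monoˡ-≤ D x≤K-d)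
        where
        cancel : ∀ K D → K ℤ.- D ℤ.+ D ≡ K
        cancel = solve-∀

    module _ (Wbⁿ<aⁿ : W ℕ.* b ℕ.^ n ℕ.< a ℕ.^ n) (d<a+b : d ℕ.< a ℕ.+ b) where

      φ-digits : ∀ u → u ∈ˢ (𝒜 ⊕ 𝒜) → φ u ∈ˢ 𝒜
      φ-digits u u∈ j with shifted-sum-digit _ (u∈ (j ℤ.- + toℕ (fromℕ n)))
      ... | k , eq , k≤W = Φ-digit Wbⁿ<aⁿ (λ i → u (j ℤ.- + toℕ i)) k eq k≤W

      module Supported (u : Seq) (N₀ : ℕ) (supp : SupportedIn N₀ u) where

        M : ℕ
        M = N₀ ℕ.+ n

        q-vanish : ∀ j → M ℕ.≤ ∣ j ∣ → q u j ≡ 0ℤ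
        q-vanish j M≤∣j∣ = trans (carry-cong zero-digit) (carry-zero d<a+b Wbⁿ<aⁿ)
          where
          zero-digit : ∀ (i : Fin n) → u (j ℤ.- + toℕ i) ≡ 0ℤ
          zero-digit i = supp _ (outside-shift N₀ (toℕ i) j (ℕP.<-≤-trans (ℕP.+-monoʳ-< N₀ (toℕ<n i)) M≤∣j∣))

        u-vanish : ∀ j → M ℕ.< ∣ j ∣ → u j ≡ 0ℤ
        u-vanish j M<∣j∣ = supp j (ℕP.≤-<-trans (ℕP.m≤m+n N₀ n) M<∣j∣)

        φ-supported : SupportedIn M (φ u)
        φ-supported j M<∣j∣ = begin
            φ u j
          ≡⟨ φ-carries u j ⟩
            u j ℤ.- A ℤ.* q u j ℤ.- B ℤ.* q u (j ℤ.- + 1)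
          ≡⟨ cong₂ (λ x y → x ℤ.- A ℤ.* y ℤ.- B ℤ.* q u (j ℤ.- + 1))
                   (u-vanish j M<∣j∣) (q-vanish j (ℕP.<⇒≤ M<∣j∣)) ⟩
            0ℤ ℤ.- A ℤ.* 0ℤ ℤ.- B ℤ.* q u (j ℤ.- + 1)
          ≡⟨ cong (λ z → 0ℤ ℤ.- A ℤ.* 0ℤ ℤ.- B ℤ.* z) (q-vanish (j ℤ.- + 1) M≤∣j-1∣) ⟩
            0ℤ ℤ.- A ℤ.* 0ℤ ℤ.- B ℤ.* 0ℤ
          ≡⟨ zeros A B ⟩
            0ℤ ∎
          where
          open ≡-Reasoning
          M≤∣j-1∣ : M ℕ.≤ ∣ j ℤ.- + 1 ∣
          M≤∣j-1∣ = ℕP.+-cancelʳ-≤ 1 M _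
            (subst (ℕ._≤ ∣ j ℤ.- + 1 ∣ ℕ.+ 1) (ℕP.+-comm 1 M) (ℕP.≤-trans M<∣j∣ (∣j∣≤∣j-k∣+k j 1)))
          zeros : ∀ A B → 0ℤ ℤ.- A ℤ.* 0ℤ ℤ.- B ℤ.* 0ℤ ≡ 0ℤ
          zeros = solve-∀

        U H : ℤ → ℚ
        U j = ι (u j) ℚ.* pow j
        H j = ι A ℚ.* ι (q u (j ℤ.- + 1)) ℚ.* pow (j ℤ.- + 1)

        -- Since b·β^j = −a·β^{j−1}, each output term is the input term minus a
        -- difference of consecutive carry terms.
        term : ∀ j → ι (φ u j) ℚ.* pow j ≡ U j ℚ.- (H (j ℤ.+ + 1) ℚ.- H j)
        term j = begin
            ι (φ u j) ℚ.* p
          ≡⟨ cong (λ v → ι v ℚ.* p) (φ-carries u j) ⟩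
            ι (u j ℤ.- A ℤ.* x ℤ.- B ℤ.* x′) ℚ.* p
          ≡⟨ cong (ℚ._* p) expand-ι ⟩
            (ι (u j) ℚ.- ι A ℚ.* ι x ℚ.- ι B ℚ.* ι x′) ℚ.* p
          ≡⟨ distribute (ι (u j)) (ι A) (ι x) (ι B) (ι x′) p ⟩
            U j ℚ.- ι A ℚ.* ι x ℚ.* p ℚ.- ι x′ ℚ.* (ι B ℚ.* p)
          ≡⟨ cong (λ e → U j ℚ.- ι A ℚ.* ι x ℚ.* p ℚ.- ι x′ ℚ.* e) base-step ⟩
            U j ℚ.- ι A ℚ.* ι x ℚ.* p ℚ.- ι x′ ℚ.* ℚ.- (ι A ℚ.* p′)
          ≡⟨ collect (U j) (ι A) (ι x) p (ι x′) p′ ⟩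
            U j ℚ.- (ι A ℚ.* ι x ℚ.* p ℚ.- H j)
          ≡⟨ cong (λ i → U j ℚ.- (ι A ℚ.* ι (q u i) ℚ.* pow i ℚ.- H j)) (sym (back-forth j)) ⟩
            U j ℚ.- (H (j ℤ.+ + 1) ℚ.- H j) ∎
          where
          open ≡-Reasoning
          x x′ : ℤ
          x  = q u j
          x′ = q u (j ℤ.- + 1)
          p p′ : ℚ
          p  = pow j
          p′ = pow (j ℤ.- + 1)
          back-forth : ∀ j → j ℤ.+ + 1 ℤ.- + 1 ≡ j
          back-forth = solve-∀
          forth-back : ∀ j → j ℤ.- + 1 ℤ.+ + 1 ≡ j
          forth-back = solve-∀
          expand-ι : ι (u j ℤ.- A ℤ.* x ℤ.- B ℤ.* x′) ≡ ι (u j) ℚ.- ι A ℚ.* ι x ℚ.- ι B ℚ.* ι x′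
          expand-ι = trans (ι-- (u j ℤ.- A ℤ.* x) (B ℤ.* x′))
            (cong₂ ℚ._-_ (trans (ι-- (u j) (A ℤ.* x)) (cong (ℚ._-_ (ι (u j))) (ι-* A x))) (ι-* B x′))
          base-step : ι B ℚ.* p ≡ ℚ.- (ι A ℚ.* p′)
          base-step = trans (cong (λ i → ι B ℚ.* pow i) (sym (forth-back j))) (βpow-step (j ℤ.- + 1))
          distribute : ∀ u a x b x′ p →
            (u ℚ.- a ℚ.* x ℚ.- b ℚ.* x′) ℚ.* p ≡ u ℚ.* p ℚ.- a ℚ.* x ℚ.* p ℚ.- x′ ℚ.* (b ℚ.* p)
          distribute = solve 6 (λ u a x b x′ p →
            (u :- a :* x :- b :* x′) :* p := u :* p :- a :* x :* p :- x′ :* (b :* p)) refl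
          collect : ∀ U a x p x′ p′ →
            U ℚ.- a ℚ.* x ℚ.* p ℚ.- x′ ℚ.* ℚ.- (a ℚ.* p′) ≡ U ℚ.- (a ℚ.* x ℚ.* p ℚ.- a ℚ.* x′ ℚ.* p′)
          collect = solve 6 (λ U a x p x′ p′ →
            U :- a :* x :* p :- x′ :* (:- (a :* p′)) := U :- (a :* x :* p :- a :* x′ :* p′)) refl

        U-vanish : ∀ j → N₀ ℕ.< ∣ j ∣ → U j ≡ 0ℚ
        U-vanish j N₀<∣j∣ = trans (cong (λ v → ι v ℚ.* pow j) (supp j N₀<∣j∣)) (ℚP.*-zeroˡ (pow j))

        H-vanish : ∀ j → M ℕ.≤ ∣ j ℤ.- + 1 ∣ → H j ≡ 0ℚ
        H-vanish j M≤ = trans (cong (λ c → ι A ℚ.* ι c ℚ.* pow (j ℤ.- + 1)) (q-vanish (j ℤ.- + 1) M≤))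
          (trans (cong (ℚ._* pow (j ℤ.- + 1)) (ℚP.*-zeroʳ (ι A))) (ℚP.*-zeroˡ (pow (j ℤ.- + 1))))

        -- The value of the output over [−M, M] is the value of the input: the carry
        -- terms telescope to their end values, which vanish.
        φ-value : value pow M (φ u) ≡ value pow N₀ u
        φ-value = begin
            sumFrom lo L (λ j → ι (φ u j) ℚ.* pow j)
          ≡⟨ sum-cong lo L term ⟩
            sumFrom lo L (λ j → U j ℚ.- (H (j ℤ.+ + 1) ℚ.- H j))
          ≡⟨ sum-sub lo L U _ ⟩
            sumSym M U ℚ.- sumFrom lo L (λ j → H (j ℤ.+ + 1) ℚ.- H j)
          ≡⟨ cong (ℚ._-_ (sumSym M U)) (sum-telescope lo L H) ⟩
            sumSym M U ℚ.- (H (lo ℤ.+ + L) ℚ.- H lo)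
          ≡⟨ cong₂ (λ s t → sumSym M U ℚ.- (s ℚ.- t)) H-top H-bottom ⟩
            sumSym M U ℚ.- (0ℚ ℚ.- 0ℚ)
          ≡⟨ ℚP.+-identityʳ (sumSym M U) ⟩
            sumSym M U
          ≡⟨ sumSym-extend N₀ n U U-vanish ⟩
            sumSym N₀ U ∎
          where
          open ≡-Reasoning
          lo : ℤ
          lo = ℤ.- + M
          L : ℕ
          L = suc (2 ℕ.* M)
          H-top : H (lo ℤ.+ + L) ≡ 0ℚ
          H-top = trans (cong H (past-top M)) (H-vanish (+ suc M) ℕP.≤-refl)
          H-bottom : H lo ≡ 0ℚ
          H-bottom = H-vanish lo (subst (M ℕ.≤_) ∣lo-1∣ (ℕP.m≤m+n M 1))
            where
            ∣lo-1∣ : M ℕ.+ 1 ≡ ∣ lo ℤ.- + 1 ∣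
            ∣lo-1∣ = trans (sym (ℤP.∣-i∣≡∣i∣ (+ M ℤ.+ + 1))) (cong ∣_∣ (ℤP.neg-distrib-+ (+ M) (+ 1)))

      φ-conversion : DigitSetConversion pow (𝒜 ⊕ 𝒜) 𝒜 φ
      φ-conversion = φ-digits , λ u _ N₀ supp →
        Supported.M u N₀ supp , Supported.φ-supported u N₀ supp , Supported.φ-value u N₀ supp

      parallel-addition : ParallelAddition pow 𝒜
      parallel-addition = φ , φ-conversion , suc n , φ-local

open import Data.Nat using (ℕ; suc; _<_; _≤_; _+_; NonZero)
open import Data.Nat.Coprimality using (Coprime)
open import Data.Product using (_,_)
open import Defs
open CarryRule using (module Carry)
open WindowLength using (odd-exponent)
open ParallelConverter using (module Conversion)

-- Choose an odd window length with W·bⁿ < aⁿ (W does not depend on it) and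
-- use the corresponding converter.
proposition47 : (a b : ℕ) .{{_ : NonZero a}} .{{_ : NonZero b}} →
    Coprime a b → b < a → 1 ≤ b →
    (d : ℕ) → d < a + b →
    ParallelAddition (βpow a b) 𝒜[ a , b , d ]
proposition47 (suc a₁) (suc b₁) _ b<a 1≤b d d<a+b
  with odd-exponent (suc a₁) (suc b₁) (Carry.W a₁ b₁ d 0) b<a 1≤b
... | m , Wbⁿ<aⁿ = Conversion.parallel-addition a₁ b₁ d m Wbⁿ<aⁿ d<a+b
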